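{- Let $m,n\ge1$. The map sending a positive integral frieze $F$ on $A_{m,n}$ to the family $u_{i,j}=F(\gamma_{i,j})$, $i,j\in\mathbb Z$, is a bijection between positive integral friezes on $A_{m,n}$ and positive integral $(m,n)$-periodic bi-infinite quasi-friezes.
   Context: A bi-infinite quasi-frieze (BiQF) is a family $(u_{i,j})_{i,j\in\mathbb Z}$ of real numbers satisfying $u_{i,j}u_{i+1,j+1}-u_{i,j+1}u_{i+1,j}=-1$ for all $i,j$; positive integral if all entries are positive integers; $(m,n)$-periodic if $u_{i+m,j+n}=u_{i,j}$ for all $i,j$. $A_{m,n}$ is an annulus with marked points $P_1,\dots,P_m$ on one boundary component and $Q_1,\dots,Q_n$ on the other. An arc is a non-contractible simple curve with endpoints at marked points, up to isotopy; boundary segments between consecutive marked points are arcs too. A quadrilateral $ABCD$ is a collection of pairwise non-crossing arcs $AB,BC,CD,DA$ cutting out a disc with vertices in this cyclic order. A positive integral frieze assigns a positive integer $F(\gamma)$ to every arc with $F=1$ on boundary segments and $F(AC)F(BD)=F(AB)F(CD)+F(BC)F(AD)$ for every quadrilateral $ABCD$. In the universal cover (an infinite strip) marked points lift to $\hat P_i$, $\hat Q_j$ ($i,j\in\mathbb Z$) on the two boundary lines, $\hat P_i$ over $P_{i'}$ with $i'\equiv i\pmod m$, $\hat Q_j$ over $Q_{j'}$ with $j'\equiv j\pmod n$, deck generator $\hat P_i\mapsto\hat P_{i+m}$, $\hat Q_j\mapsto\hat Q_{j+n}$, labels chosen so that $\hat P_i,\hat P_{i+1},\hat Q_{j+1},\hat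 Q_j$ form a quadrilateral in this cyclic order. $\gamma_{i,j}$ is the bridging arc that is the image of the segment $\hat P_i\hat Q_j$. -}

module Defs where

open import Data.Nat as ℕ using (ℕ)
open import Data.Integer using (ℤ; +_; _+_; _-_; _*_; ∣_∣; _<_)
open import Data.Product using (Σ; ∃; _×_; _,_)
open import Data.Sum using (_⊎_)
open import Data.Empty using (⊥)
open import Relation.Nullary using (¬_)
open import Relation.Binary.PropositionalEquality using (_≡_)

-- Marked points of the universal cover (infinite strip) of A_{m,n}:
-- P i  is  \hat P_i  (on one boundary line),  Q j  is  \hat Q_j.

data Pt : Set where
  P : ℤ → Pt
  Q : ℤ → Pt

-- Deck transformation τ^k : \hat P_i ↦ \hat P_{i+km}, \hat Q_j ↦ \hat Q_{j+kn}.
shift : ℕ → ℕ → ℤ → Pt → Pt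
shift m n k (P i) = P (i + k * + m)
shift m n k (Q j) = Q (j + k * + n)

-- Linear order on the boundary of the strip, cut open at -∞:
-- the P-line in increasing order, then (through +∞) the Q-line in
-- decreasing order.
data _<ₚ_ : Pt → Pt → Set where
  PP : ∀ {i k} → i < k → P i <ₚ P k
  PQ : ∀ {i j} → P i <ₚ Q j
  QQ : ∀ {j l} → l < j → Q j <ₚ Q l

Inc4 : Pt → Pt → Pt → Pt → Set
Inc4 w x y z = (w <ₚ x) × (x <ₚ y) × (y <ₚ z)

Cyclic : Pt → Pt → Pt → Pt → Set
Cyclic A B C D =
  Inc4 A B C D ⊎ Inc4 B C D A ⊎ Inc4 C D A B ⊎ Inc4 D A B C ⊎
  Inc4 D C B A ⊎ Inc4 C B A D ⊎ Inc4 B A D C ⊎ Inc4 A D C B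

-- The chords AB and CD of the strip cross in their interiors
-- (their endpoints are distinct and interleave).
Cross : Pt → Pt → Pt → Pt → Set
Cross A B C D =
  Inc4 A C B D ⊎ Inc4 A D B C ⊎ Inc4 B C A D ⊎ Inc4 B D A C ⊎
  Inc4 C A D B ⊎ Inc4 C B D A ⊎ Inc4 D A C B ⊎ Inc4 D B C A

-- Arcs of A_{m,n}: a lifted segment of the strip whose image in the annulus
-- is an arc (simple, non-contractible; boundary segments included).
--  * bridging: \hat P_i — \hat Q_j, always;
--  * peripheral: \hat P_i — \hat P_k with 1 ≤ |k - i| ≤ m
--    (resp. \hat Q_j — \hat Q_l with 1 ≤ |l - j| ≤ n);
--    |k - i| = 1 are the boundary segments.

data IsArc (m n : ℕ) : Pt → Pt → Set where
  bPQ : ∀ {i j} → IsArc m n (P i) (Q j)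
  bQP : ∀ {i j} → IsArc m n (Q j) (P i)
  pP  : ∀ {i k} → 1 ℕ.≤ ∣ k - i ∣ → ∣ k - i ∣ ℕ.≤ m → IsArc m n (P i) (P k)
  pQ  : ∀ {j l} → 1 ℕ.≤ ∣ l - j ∣ → ∣ l - j ∣ ℕ.≤ n → IsArc m n (Q j) (Q l)

-- An arc, represented by one of its lifts.
record Arc (m n : ℕ) : Set where
  constructor arc
  field
    src : Pt
    tgt : Pt
    valid : IsArc m n src tgt
open Arc public

-- Two lifts represent the same arc of A_{m,n} (same isotopy class):
-- they differ by a deck transformation, possibly with reversed orientation.
_≈A_ : ∀ {m n} → Arc m n → Arc m n → Set
_≈A_ {m} {n} α β = ∃ λ k →
  ((src β ≡ shift m n k (src α)) × (tgt β ≡ shift m n k (tgt α))) ⊎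
  ((src β ≡ shift m n k (tgt α)) × (tgt β ≡ shift m n k (src α)))

IsBdrySeg : Pt → Pt → Set
IsBdrySeg (P i) (P k) = ∣ k - i ∣ ≡ 1
IsBdrySeg (Q j) (Q l) = ∣ l - j ∣ ≡ 1
IsBdrySeg (P _) (Q _) = ⊥
IsBdrySeg (Q _) (P _) = ⊥

Crosses : ∀ {m n} → Arc m n → Arc m n → Set
Crosses {m} {n} α β = ∃ λ k → Cross (src α) (tgt α) (shift m n k (src β)) (shift m n k (tgt β))

NonCrossing : ∀ {m n} → Arc m n → Arc m n → Set
NonCrossing α β = ¬ Crosses α β

record Quad (m n : ℕ) (A B C D : Pt) : Set where
  field
    cyc : Cyclic A B C D
    ab : IsArc m n A B
    bc : IsArc m n B C
    cd : IsArc m n C D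
    da : IsArc m n D A
    ac : IsArc m n A C
    bd : IsArc m n B D
    nc-ab-bc : NonCrossing (arc A B ab) (arc B C bc)
    nc-ab-cd : NonCrossing (arc A B ab) (arc C D cd)
    nc-ab-da : NonCrossing (arc A B ab) (arc D A da)
    nc-bc-cd : NonCrossing (arc B C bc) (arc C D cd)
    nc-bc-da : NonCrossing (arc B C bc) (arc D A da)
    nc-cd-da : NonCrossing (arc C D cd) (arc D A da)

record Frieze (m n : ℕ) : Set where
  field
    F : Arc m n → ℕ
    F-resp : ∀ α β → α ≈A β → F α ≡ F β
    F-pos : ∀ α → 0 ℕ.< F α
    F-bdry : ∀ α → IsBdrySeg (src α) (tgt α) → F α ≡ 1
    ptolemy : ∀ A B C D → (q : Quad m n A B C D) →
      F (arc A C (Quad.ac q)) ℕ.* F (arc B D (Quad.bd q)) ≡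
      F (arc A B (Quad.ab q)) ℕ.* F (arc C D (Quad.cd q)) ℕ.+
      F (arc B C (Quad.bc q)) ℕ.* F (arc D A (Quad.da q))
open Frieze public

γ : ∀ {m n} → ℤ → ℤ → Arc m n
γ i j = arc (P i) (Q j) bPQ

-- Bi-infinite quasi-friezes with positive integer entries.
-- u_{i,j} u_{i+1,j+1} - u_{i,j+1} u_{i+1,j} = -1, written over ℕ.

IsPosIntBiQF : (ℤ → ℤ → ℕ) → Set
IsPosIntBiQF u =
  (∀ i j → 0 ℕ.< u i j) ×
  (∀ i j → u i j ℕ.* u (i + + 1) (j + + 1) ℕ.+ 1 ≡ u i (j + + 1) ℕ.* u (i + + 1) j)

Periodic : ℕ → ℕ → (ℤ → ℤ → ℕ) → Set
Periodic m n u = ∀ i j → u (i + + m) (j + + n) ≡ u i j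

toBiQF : ∀ {m n} → Frieze m n → ℤ → ℤ → ℕ
toBiQF Fr i j = F Fr (γ i j)

-- A frieze is determined by its values u i j = F (γ i j) through the Ptolemy relations of three kinds of
-- quadrilaterals: the square P_i P_(i+1) Q_(j+1) Q_j gives the quasi-frieze relation, and the fans
-- P_i P_(i+d) P_(i+d+1) Q_j and Q_(l+d+1) Q_(l+d) Q_l P_i express every peripheral arc through a shorter one,
-- after cancelling a positive bridging value.
--
-- Conversely, a positive integral quasi-frieze u is realised by vectors a i, b j ∈ ℤ² with det (a i) (b j) = u i j
-- and det (a i) (a (i+1)) = det (b (j+1)) (b j) = 1.  Then G = det on the lifted marked points satisfies the
-- Plücker relation, is positive on pairs in boundary order, and by periodicity is invariant under the deck
-- transformation.  For four points in boundary order all six values of G are positive, so the Plücker relation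
-- is Ptolemy's relation for |G|, and |G| is a frieze.

module Submission where

open import Defs
open import Data.Nat using (ℕ; _≤_)
open import Data.Integer using (ℤ)
open import Data.Product using (Σ; _×_)
open import Relation.Binary.PropositionalEquality using (_≡_)

open import Data.Nat using (zero; suc; z≤n; s≤s)
import Data.Nat as ℕ
import Data.Nat.Properties as ℕₚ
open import Data.Integer using (+_; -[1+_]; 0ℤ; 1ℤ; -1ℤ; _+_; _-_; _*_; -_; ∣_∣; +<+; +≤+; -≤+; -≤-)
import Data.Integer as ℤ
import Data.Integer.Properties as ℤₚ
open import Data.Integer.Tactic.RingSolver using (solve-∀)
open import Data.Product using (_,_; ∃; proj₁; proj₂)
open import Data.Sum as Sum using (_⊎_; inj₁; inj₂; [_,_])
open import Data.Empty using (⊥; ⊥-elim)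
open import Relation.Nullary using (¬_)
open import Relation.Binary.PropositionalEquality
  using (refl; sym; trans; cong; cong₂; subst; subst₂; module ≡-Reasoning)

ℤ-induction : (Pr : ℤ → Set) → Pr 0ℤ → (∀ i → Pr i → Pr (i + 1ℤ)) → (∀ i → Pr (i + 1ℤ) → Pr i) →
              ∀ i → Pr i
ℤ-induction Pr base up down (+ zero)     = base
ℤ-induction Pr base up down (+ suc n)    =
  subst Pr (cong +_ (ℕₚ.+-comm n 1)) (up (+ n) (ℤ-induction Pr base up down (+ n)))
ℤ-induction Pr base up down -[1+ zero ]  = down -1ℤ base
ℤ-induction Pr base up down -[1+ suc n ] = down -[1+ suc n ] (ℤ-induction Pr base up down -[1+ n ])

i≡j+[i-j] : ∀ i j → i ≡ j + (i - j)
i≡j+[i-j] = solve-∀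

i≡j-[j-i] : ∀ i j → i ≡ j - (j - i)
i≡j-[j-i] = solve-∀

i+[1+j]≡[i+j]+1 : ∀ i j → i + (1ℤ + j) ≡ (i + j) + 1ℤ
i+[1+j]≡[i+j]+1 = solve-∀

[i+1]+s≡[i+s]+1 : ∀ i s → (i + 1ℤ) + s ≡ (i + s) + 1ℤ
[i+1]+s≡[i+s]+1 = solve-∀

[i+k*s]+-k*s≡i : ∀ i k s → (i + k * s) + - k * s ≡ i
[i+k*s]+-k*s≡i = solve-∀

i<i+suc : ∀ i d → i ℤ.< i + + suc d
i<i+suc i d = subst (ℤ._< i + + suc d) (ℤₚ.+-identityʳ i) (ℤₚ.+-monoʳ-< i (+<+ (s≤s z≤n)))

no-integer-between : ∀ {i x} → i ℤ.< x → x ℤ.< i + 1ℤ → ⊥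
no-integer-between {i} i<x x<i+1 =
  ℤₚ.<⇒≱ x<i+1 (subst (ℤ._≤ _) (ℤₚ.+-comm 1ℤ i) (ℤₚ.i<j⇒suc[i]≤j i<x))

<⇒≡+suc : ∀ {i k} → i ℤ.< k → ∃ λ d → k ≡ i + + suc d
<⇒≡+suc {i} {k} i<k with k - i in k-i≡ | subst (ℤ._< k - i) (ℤₚ.+-inverseʳ i) (ℤₚ.+-monoˡ-< (- i) i<k)
... | + suc d  | _       = d , trans (i≡j+[i-j] k i) (cong (_+_ i) k-i≡)
... | + zero   | +<+ ()
... | -[1+ _ ] | ()

apart-by : ∀ {i k ℓ} → 1 ≤ ∣ k - i ∣ → ∣ k - i ∣ ≤ ℓ →
        ∃ λ d → suc d ≤ ℓ × (k ≡ i + + suc d ⊎ i ≡ k + + suc d)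
apart-by {i} {k} 1≤ ≤ℓ with k - i in k-i≡
... | + zero   = ⊥-elim (ℕₚ.<-irrefl refl 1≤)
... | + suc d  = d , ≤ℓ , inj₁ (trans (i≡j+[i-j] k i) (cong (_+_ i) k-i≡))
... | -[1+ d ] = d , ≤ℓ , inj₂ (trans (i≡j-[j-i] i k) (cong (_-_ k) k-i≡))

∣i-j∣≡1⇒i≡j±1 : ∀ {i j} → ∣ i - j ∣ ≡ 1 → i ≡ j + 1ℤ ⊎ j ≡ i + 1ℤ
∣i-j∣≡1⇒i≡j±1 {i} {j} ∣i-j∣≡ with i - j in i-j≡ | ∣i-j∣≡
... | + 1          | _ = inj₁ (trans (i≡j+[i-j] i j) (cong (_+_ j) i-j≡))
... | -[1+ 0 ]     | _ = inj₂ (trans (i≡j-[j-i] j i) (cong (_-_ i) i-j≡))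
... | + 0          | ()
... | + suc (suc _) | ()
... | -[1+ suc _ ] | ()

*-pos : ∀ {x y} → 0ℤ ℤ.< x → 0ℤ ℤ.< y → 0ℤ ℤ.< x * y
*-pos {y = y} 0<x 0<y = ℤₚ.*-monoʳ-<-pos y ⦃ ℤ.positive 0<y ⦄ 0<x

pos-*-cancelʳ : ∀ {x y} → 0ℤ ℤ.< y → 0ℤ ℤ.< x * y → 0ℤ ℤ.< x
pos-*-cancelʳ {y = + suc n} _        = ℤₚ.*-cancelʳ-<-nonNeg (+ suc n)
pos-*-cancelʳ {y = + zero}  (+<+ ())

pos-*-cancelˡ : ∀ {x y} → 0ℤ ℤ.< x → 0ℤ ℤ.< x * y → 0ℤ ℤ.< y
pos-*-cancelˡ {x} {y} 0<x 0<xy = pos-*-cancelʳ 0<x (subst (0ℤ ℤ.<_) (ℤₚ.*-comm x y) 0<xy)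

0<⇒0<∣∣ : ∀ {x} → 0ℤ ℤ.< x → 0 ℕ.< ∣ x ∣
0<⇒0<∣∣ (+<+ 0<n) = 0<n

-- Matching makes all six factors + suc _, on which ∣_∣ commutes with + and * by computation.
abs-ptolemy : ∀ {a b c d e f} → 0ℤ ℤ.< a → 0ℤ ℤ.< b → 0ℤ ℤ.< c → 0ℤ ℤ.< d → 0ℤ ℤ.< e → 0ℤ ℤ.< f →
              a * b ≡ c * d + e * f → ∣ a ∣ ℕ.* ∣ b ∣ ≡ ∣ c ∣ ℕ.* ∣ d ∣ ℕ.+ ∣ e ∣ ℕ.* ∣ f ∣
abs-ptolemy (+<+ (s≤s z≤n)) (+<+ (s≤s z≤n)) (+<+ (s≤s z≤n)) (+<+ (s≤s z≤n)) (+<+ (s≤s z≤n))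
            (+<+ (s≤s z≤n)) eq = cong ∣_∣ eq

-- Marked points of the strip

<ₚ-trans : ∀ {x y z} → x <ₚ y → y <ₚ z → x <ₚ z
<ₚ-trans (PP p) (PP q) = PP (ℤₚ.<-trans p q)
<ₚ-trans (PP _) PQ     = PQ
<ₚ-trans PQ     (QQ _) = PQ
<ₚ-trans (QQ p) (QQ q) = QQ (ℤₚ.<-trans q p)

<ₚ-irrefl : ∀ {x} → ¬ x <ₚ x
<ₚ-irrefl (PP p) = ℤₚ.<-irrefl refl p
<ₚ-irrefl (QQ p) = ℤₚ.<-irrefl refl p

<ₚ-asym : ∀ {x y} → x <ₚ y → ¬ y <ₚ x
<ₚ-asym p q = <ₚ-irrefl (<ₚ-trans p q)

<ₚ-shift : ∀ {m n x y} k → x <ₚ y → shift m n k x <ₚ shift m n k y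
<ₚ-shift {m}     k (PP p) = PP (ℤₚ.+-monoˡ-< (k * + m) p)
<ₚ-shift         k PQ     = PQ
<ₚ-shift {n = n} k (QQ p) = QQ (ℤₚ.+-monoˡ-< (k * + n) p)

shift-inverse : ∀ {m n} k x → shift m n (- k) (shift m n k x) ≡ x
shift-inverse {m}     k (P i) = cong P ([i+k*s]+-k*s≡i i k (+ m))
shift-inverse {n = n} k (Q j) = cong Q ([i+k*s]+-k*s≡i j k (+ n))

Between : Pt → Pt → Pt → Set
Between x y z = x <ₚ y × y <ₚ z

data Adjacent : Pt → Pt → Set where
  P-step : ∀ {i k} → k ≡ i + 1ℤ → Adjacent (P i) (P k)
  Q-step : ∀ {j l} → j ≡ l + 1ℤ → Adjacent (Q j) (Q l)

Adjacent⇒<ₚ : ∀ {x y} → Adjacent x y → x <ₚ y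
Adjacent⇒<ₚ (P-step {i} refl)     = PP (i<i+suc i 0)
Adjacent⇒<ₚ (Q-step {l = l} refl) = QQ (i<i+suc l 0)

Adjacent⇒nothing-between : ∀ {x y z} → Adjacent x z → ¬ Between x y z
Adjacent⇒nothing-between (P-step refl) (PP p , PP q) = no-integer-between p q
Adjacent⇒nothing-between (P-step _)    (PQ , ())
Adjacent⇒nothing-between (Q-step refl) (QQ p , QQ q) = no-integer-between q p

Adjacent-shift : ∀ {m n x y} k → Adjacent x y → Adjacent (shift m n k x) (shift m n k y)
Adjacent-shift {m}     k (P-step {i} refl)     = P-step ([i+1]+s≡[i+s]+1 i (k * + m))
Adjacent-shift {n = n} k (Q-step {l = l} refl) = Q-step ([i+1]+s≡[i+s]+1 l (k * + n))

Adjacent⇒IsBdrySeg : ∀ {x y} → Adjacent x y → IsBdrySeg x y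
Adjacent⇒IsBdrySeg (P-step {i} refl)     = cong ∣_∣ ([i+1]-i≡1 i)
  where [i+1]-i≡1 : ∀ i → (i + 1ℤ) - i ≡ 1ℤ
        [i+1]-i≡1 = solve-∀
Adjacent⇒IsBdrySeg (Q-step {l = l} refl) = cong ∣_∣ (i-[i+1]≡-1 l)
  where i-[i+1]≡-1 : ∀ i → i - (i + 1ℤ) ≡ -1ℤ
        i-[i+1]≡-1 = solve-∀

IsBdrySeg⇒Adjacent : ∀ {x y} → IsBdrySeg x y → Adjacent x y ⊎ Adjacent y x
IsBdrySeg⇒Adjacent {P _} {P _} bdry = Sum.map P-step P-step (∣i-j∣≡1⇒i≡j±1 bdry)
IsBdrySeg⇒Adjacent {Q _} {Q _} bdry = Sum.swap (Sum.map Q-step Q-step (∣i-j∣≡1⇒i≡j±1 bdry))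

Adjacent⇒IsArc : ∀ {m n x y} → 1 ≤ m → 1 ≤ n → Adjacent x y → IsArc m n x y
Adjacent⇒IsArc 1≤m _ adj@(P-step _) =
  pP (ℕₚ.≤-reflexive (sym (Adjacent⇒IsBdrySeg adj))) (subst (_≤ _) (sym (Adjacent⇒IsBdrySeg adj)) 1≤m)
Adjacent⇒IsArc _ 1≤n adj@(Q-step _) =
  pQ (ℕₚ.≤-reflexive (sym (Adjacent⇒IsBdrySeg adj))) (subst (_≤ _) (sym (Adjacent⇒IsBdrySeg adj)) 1≤n)

IsArc-sym : ∀ {m n x y} → IsArc m n x y → IsArc m n y x
IsArc-sym bPQ                = bQP
IsArc-sym bQP                = bPQ
IsArc-sym (pP {i} {k} 1≤ ≤m) = pP (subst (1 ≤_) (ℤₚ.∣i-j∣≡∣j-i∣ k i) 1≤) (subst (_≤ _) (ℤₚ.∣i-j∣≡∣j-i∣ k i) ≤m)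
IsArc-sym (pQ {j} {l} 1≤ ≤n) = pQ (subst (1 ≤_) (ℤₚ.∣i-j∣≡∣j-i∣ l j) 1≤) (subst (_≤ _) (ℤₚ.∣i-j∣≡∣j-i∣ l j) ≤n)

IsArc⇒<ₚ⊎>ₚ : ∀ {m n x y} → IsArc m n x y → x <ₚ y ⊎ y <ₚ x
IsArc⇒<ₚ⊎>ₚ bPQ = inj₁ PQ
IsArc⇒<ₚ⊎>ₚ bQP = inj₂ PQ
IsArc⇒<ₚ⊎>ₚ (pP {i} {k} 1≤ ≤m) with apart-by {i} {k} 1≤ ≤m
... | d , _ , inj₁ refl = inj₁ (PP (i<i+suc _ d))
... | d , _ , inj₂ refl = inj₂ (PP (i<i+suc _ d))
IsArc⇒<ₚ⊎>ₚ (pQ {j} {l} 1≤ ≤n) with apart-by {j} {l} 1≤ ≤n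
... | d , _ , inj₁ refl = inj₂ (QQ (i<i+suc _ d))
... | d , _ , inj₂ refl = inj₁ (QQ (i<i+suc _ d))

-- Crossings

pattern in₁ x = inj₁ x
pattern in₂ x = inj₂ (inj₁ x)
pattern in₃ x = inj₂ (inj₂ (inj₁ x))
pattern in₄ x = inj₂ (inj₂ (inj₂ (inj₁ x)))
pattern in₅ x = inj₂ (inj₂ (inj₂ (inj₂ (inj₁ x))))
pattern in₆ x = inj₂ (inj₂ (inj₂ (inj₂ (inj₂ (inj₁ x)))))
pattern in₇ x = inj₂ (inj₂ (inj₂ (inj₂ (inj₂ (inj₂ (inj₁ x))))))
pattern in₈ x = inj₂ (inj₂ (inj₂ (inj₂ (inj₂ (inj₂ (inj₂ x))))))

cross-sym : ∀ {A B C D} → Cross A B C D → Cross C D A B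
cross-sym (in₁ x) = in₅ x
cross-sym (in₂ x) = in₆ x
cross-sym (in₃ x) = in₇ x
cross-sym (in₄ x) = in₈ x
cross-sym (in₅ x) = in₁ x
cross-sym (in₆ x) = in₂ x
cross-sym (in₇ x) = in₃ x
cross-sym (in₈ x) = in₄ x

Cross-map : ∀ {f : Pt → Pt} → (∀ {x y} → x <ₚ y → f x <ₚ f y) →
            ∀ {A B C D} → Cross A B C D → Cross (f A) (f B) (f C) (f D)
Cross-map mono (in₁ (p , q , r)) = in₁ (mono p , mono q , mono r)
Cross-map mono (in₂ (p , q , r)) = in₂ (mono p , mono q , mono r)
Cross-map mono (in₃ (p , q , r)) = in₃ (mono p , mono q , mono r)
Cross-map mono (in₄ (p , q , r)) = in₄ (mono p , mono q , mono r)
Cross-map mono (in₅ (p , q , r)) = in₅ (mono p , mono q , mono r)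
Cross-map mono (in₆ (p , q , r)) = in₆ (mono p , mono q , mono r)
Cross-map mono (in₇ (p , q , r)) = in₇ (mono p , mono q , mono r)
Cross-map mono (in₈ (p , q , r)) = in₈ (mono p , mono q , mono r)

cross⇒between : ∀ {A B C D} → A <ₚ B → Cross A B C D → Between A C B ⊎ Between A D B
cross⇒between _   (in₁ (a<c , c<b , _)) = inj₁ (a<c , c<b)
cross⇒between _   (in₂ (a<d , d<b , _)) = inj₂ (a<d , d<b)
cross⇒between a<b (in₃ (b<c , c<a , _)) = ⊥-elim (<ₚ-asym a<b (<ₚ-trans b<c c<a))
cross⇒between a<b (in₄ (b<d , d<a , _)) = ⊥-elim (<ₚ-asym a<b (<ₚ-trans b<d d<a))
cross⇒between _   (in₅ (_ , a<d , d<b)) = inj₂ (a<d , d<b)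
cross⇒between a<b (in₆ (_ , b<d , d<a)) = ⊥-elim (<ₚ-asym a<b (<ₚ-trans b<d d<a))
cross⇒between _   (in₇ (_ , a<c , c<b)) = inj₁ (a<c , c<b)
cross⇒between a<b (in₈ (_ , b<c , c<a)) = ⊥-elim (<ₚ-asym a<b (<ₚ-trans b<c c<a))

cross-bridging : ∀ {a b c d} → Cross (P a) (Q b) (Q d) (P c) →
                 (a ℤ.< c × d ℤ.< b) ⊎ (c ℤ.< a × b ℤ.< d)
cross-bridging (in₂ (PP a<c , PQ , QQ d<b)) = inj₁ (a<c , d<b)
cross-bridging (in₇ (PP c<a , PQ , QQ b<d)) = inj₂ (c<a , b<d)
cross-bridging (in₁ (_ , _ , ()))
cross-bridging (in₃ (_ , () , _))
cross-bridging (in₄ (() , _ , _))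
cross-bridging (in₅ (() , _ , _))
cross-bridging (in₆ (_ , () , _))
cross-bridging (in₈ (_ , _ , ()))

≤0⊎≥1 : ∀ k → k ℤ.≤ 0ℤ ⊎ 1ℤ ℤ.≤ k
≤0⊎≥1 (+ zero)  = inj₁ ℤₚ.≤-refl
≤0⊎≥1 (+ suc _) = inj₂ (+≤+ (s≤s z≤n))
≤0⊎≥1 -[1+ _ ]  = inj₁ -≤+

≤-1⊎≥0 : ∀ k → k ℤ.≤ -1ℤ ⊎ 0ℤ ℤ.≤ k
≤-1⊎≥0 (+ _)    = inj₂ (+≤+ z≤n)
≤-1⊎≥0 -[1+ _ ] = inj₁ (-≤- z≤n)

module _ (c : ℤ) (M : ℕ) where

  translate-mono : ∀ {k l} → k ℤ.≤ l → c + k * + M ℤ.≤ c + l * + M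
  translate-mono k≤l = ℤₚ.+-monoʳ-≤ c (ℤₚ.*-monoʳ-≤-nonNeg (+ M) k≤l)

  translate-nonpos : ∀ {k} → k ℤ.≤ 0ℤ → c + k * + M ℤ.≤ c
  translate-nonpos {k} k≤0 = subst (c + k * + M ℤ.≤_) (ℤₚ.+-identityʳ c) (translate-mono k≤0)

  translate-nonneg : ∀ {k} → 0ℤ ℤ.≤ k → c ℤ.≤ c + k * + M
  translate-nonneg {k} 0≤k = subst (ℤ._≤ c + k * + M) (ℤₚ.+-identityʳ c) (translate-mono 0≤k)

  translate-pos : ∀ {k} → 1ℤ ℤ.≤ k → c + + M ℤ.≤ c + k * + M
  translate-pos {k} 1≤k = subst (ℤ._≤ c + k * + M) (cong (_+_ c) (ℤₚ.*-identityˡ (+ M))) (translate-mono 1≤k)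

  translate-neg : ∀ {k} → k ℤ.≤ -1ℤ → (c + k * + M) + + M ℤ.≤ c
  translate-neg {k} k≤-1 = subst ((c + k * + M) + + M ℤ.≤_) (cancel c (+ M)) (ℤₚ.+-monoˡ-≤ (+ M) (translate-mono k≤-1))
    where cancel : ∀ c M → (c + -1ℤ * M) + M ≡ c
          cancel = solve-∀

module _ (M : ℕ) {a b c : ℤ} where

  translates-avoid-below : c ℤ.≤ a → b ℤ.≤ c + + M → ∀ k → ¬ (a ℤ.< c + k * + M × c + k * + M ℤ.< b)
  translates-avoid-below c≤a b≤c+M k (a<x , x<b) with ≤0⊎≥1 k
  ... | inj₁ k≤0 = ℤₚ.<⇒≱ a<x (ℤₚ.≤-trans (translate-nonpos c M k≤0) c≤a)
  ... | inj₂ 1≤k = ℤₚ.<⇒≱ x<b (ℤₚ.≤-trans b≤c+M (translate-pos c M 1≤k))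

  translates-avoid-above : b ℤ.≤ c → c ℤ.≤ a + + M → ∀ k → ¬ (a ℤ.< c + k * + M × c + k * + M ℤ.< b)
  translates-avoid-above b≤c c≤a+M k (a<x , x<b) with ≤-1⊎≥0 k
  ... | inj₁ k≤-1 = ℤₚ.<⇒≱ (ℤₚ.+-monoˡ-< (+ M) a<x) (ℤₚ.≤-trans (translate-neg c M k≤-1) c≤a+M)
  ... | inj₂ 0≤k  = ℤₚ.<⇒≱ x<b (ℤₚ.≤-trans b≤c (translate-nonneg c M 0≤k))

module Separation (m n : ℕ) where

  -- NonCrossing (arc A B p) (arc C D q) unfolds to Separated A B C D, whatever p and q are.  Points that
  -- occur only under shift are passed explicitly below: unification cannot recover them once shift computes.
  Separated : Pt → Pt → Pt → Pt → Set
  Separated A B C D = ¬ ∃ λ k → Cross A B (shift m n k C) (shift m n k D)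

  separated-sym : ∀ {A B C D} → Separated A B C D → Separated C D A B
  separated-sym {A} {B} sep (k , x) =
    sep (- k , cross-sym (subst₂ (Cross _ _) (shift-inverse k A) (shift-inverse k B)
                                             (Cross-map (<ₚ-shift {m} {n} (- k)) x)))

  separated-chord : ∀ {A B} C D → A <ₚ B →
                    (∀ k → ¬ Between A (shift m n k C) B) → (∀ k → ¬ Between A (shift m n k D) B) →
                    Separated A B C D
  separated-chord _ _ a<b C-outside D-outside (k , x) = [ C-outside k , D-outside k ] (cross⇒between a<b x)

  separated-adjacent : ∀ {A B} C D → Adjacent A B → Separated A B C D
  separated-adjacent C D adj =
    separated-chord C D (Adjacent⇒<ₚ adj) (λ _ → Adjacent⇒nothing-between adj) (λ _ → Adjacent⇒nothing-between adj)

  separated-bridging : ∀ {a b} c d → c ℤ.≤ a → a ℤ.≤ c + + m → d ℤ.≤ b → b ℤ.≤ d + + n →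
                       Separated (P a) (Q b) (Q d) (P c)
  separated-bridging c d c≤a a≤c+m d≤b b≤d+n (k , x) with ≤0⊎≥1 k | cross-bridging x
  ... | inj₁ k≤0 | inj₁ (a<c′ , _) = ℤₚ.<⇒≱ a<c′ (ℤₚ.≤-trans (translate-nonpos c m k≤0) c≤a)
  ... | inj₁ k≤0 | inj₂ (_ , b<d′) = ℤₚ.<⇒≱ b<d′ (ℤₚ.≤-trans (translate-nonpos d n k≤0) d≤b)
  ... | inj₂ 1≤k | inj₁ (_ , d′<b) = ℤₚ.<⇒≱ d′<b (ℤₚ.≤-trans b≤d+n (translate-pos d n 1≤k))
  ... | inj₂ 1≤k | inj₂ (c′<a , _) = ℤₚ.<⇒≱ c′<a (ℤₚ.≤-trans a≤c+m (translate-pos c m 1≤k))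

  P-outside-below : ∀ {a b} c → c ℤ.≤ a → b ℤ.≤ c + + m → ∀ k → ¬ Between (P a) (shift m n k (P c)) (P b)
  P-outside-below c c≤a b≤c+m k (PP a<x , PP x<b) = translates-avoid-below m c≤a b≤c+m k (a<x , x<b)

  P-outside-above : ∀ {a b} c → b ℤ.≤ c → c ℤ.≤ a + + m → ∀ k → ¬ Between (P a) (shift m n k (P c)) (P b)
  P-outside-above c b≤c c≤a+m k (PP a<x , PP x<b) = translates-avoid-above m b≤c c≤a+m k (a<x , x<b)

  Q-outside-below : ∀ {a b} c → c ℤ.≤ a → b ℤ.≤ c + + n → ∀ k → ¬ Between (Q b) (shift m n k (Q c)) (Q a)
  Q-outside-below c c≤a b≤c+n k (QQ x<b , QQ a<x) = translates-avoid-below n c≤a b≤c+n k (a<x , x<b)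

  Q-outside-above : ∀ {a b} c → b ℤ.≤ c → c ℤ.≤ a + + n → ∀ k → ¬ Between (Q b) (shift m n k (Q c)) (Q a)
  Q-outside-above c b≤c c≤a+n k (QQ x<b , QQ a<x) = translates-avoid-above n b≤c c≤a+n k (a<x , x<b)

  Q-outside-P-chord : ∀ {a b} j k → ¬ Between (P a) (shift m n k (Q j)) (P b)
  Q-outside-P-chord _ _ (_ , ())

  P-outside-Q-chord : ∀ {a b} i k → ¬ Between (Q b) (shift m n k (P i)) (Q a)
  P-outside-Q-chord _ _ (() , _)

-- Quadrilaterals

module Quadrilaterals {m n : ℕ} (1≤m : 1 ≤ m) (1≤n : 1 ≤ n) where

  open Separation m n

  arc-P : ∀ i d → suc d ≤ m → IsArc m n (P i) (P (i + + suc d))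
  arc-P i d ≤m = pP (subst (1 ≤_) (sym span) (s≤s z≤n)) (subst (_≤ m) (sym span) ≤m)
    where
    [i+x]-i≡x : ∀ i x → (i + x) - i ≡ x
    [i+x]-i≡x = solve-∀
    span : ∣ (i + + suc d) - i ∣ ≡ suc d
    span = cong ∣_∣ ([i+x]-i≡x i (+ suc d))

  arc-Q : ∀ l d → suc d ≤ n → IsArc m n (Q (l + + suc d)) (Q l)
  arc-Q l d ≤n = pQ (subst (1 ≤_) (sym span) (s≤s z≤n)) (subst (_≤ n) (sym span) ≤n)
    where
    i-[i+x]≡-x : ∀ i x → i - (i + x) ≡ - x
    i-[i+x]≡-x = solve-∀
    span : ∣ l - (l + + suc d) ∣ ≡ suc d
    span = cong ∣_∣ (i-[i+x]≡-x l (+ suc d))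

  private
    +-monoʳ-≤ℕ : ∀ i {x y} → x ≤ y → i + + x ℤ.≤ i + + y
    +-monoʳ-≤ℕ i x≤y = ℤₚ.+-monoʳ-≤ i (+≤+ x≤y)

  square : ∀ i j → Quad m n (P i) (P (i + 1ℤ)) (Q (j + 1ℤ)) (Q j)
  square i j = record
    { cyc = in₁ (Adjacent⇒<ₚ ab-adj , PQ , Adjacent⇒<ₚ cd-adj)
    ; ab = Adjacent⇒IsArc 1≤m 1≤n ab-adj ; bc = bPQ ; cd = Adjacent⇒IsArc 1≤m 1≤n cd-adj ; da = bQP
    ; ac = bPQ ; bd = bPQ
    ; nc-ab-bc = separated-adjacent (P (i + 1ℤ)) (Q (j + 1ℤ)) ab-adj
    ; nc-ab-cd = separated-adjacent (Q (j + 1ℤ)) (Q j) ab-adj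
    ; nc-ab-da = separated-adjacent (Q j) (P i) ab-adj
    ; nc-bc-cd = separated-sym (separated-adjacent (P (i + 1ℤ)) (Q (j + 1ℤ)) cd-adj)
    ; nc-bc-da = separated-bridging i j (ℤₚ.i≤i+j i 1ℤ) (+-monoʳ-≤ℕ i 1≤m) (ℤₚ.i≤i+j j 1ℤ) (+-monoʳ-≤ℕ j 1≤n)
    ; nc-cd-da = separated-adjacent (Q j) (P i) cd-adj
    }
    where
    ab-adj : Adjacent (P i) (P (i + 1ℤ))
    ab-adj = P-step refl
    cd-adj : Adjacent (Q (j + 1ℤ)) (Q j)
    cd-adj = Q-step refl

  peripheral-P : ∀ i j d → suc (suc d) ≤ m → Quad m n (P i) (P (i + + suc d)) (P (i + + suc (suc d))) (Q j)
  peripheral-P i j d D≤m = record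
    { cyc = in₁ (PP (i<i+suc i d) , Adjacent⇒<ₚ bc-adj , PQ)
    ; ab = arc-P i d d+1≤m ; bc = Adjacent⇒IsArc 1≤m 1≤n bc-adj ; cd = bPQ ; da = bQP
    ; ac = arc-P i (suc d) D≤m ; bd = bPQ
    ; nc-ab-bc = separated-sym (separated-adjacent (P i) (P i₁) bc-adj)
    ; nc-ab-cd = separated-chord (P i₂) (Q j) (PP (i<i+suc i d))
        (P-outside-above i₂ (+-monoʳ-≤ℕ i (ℕₚ.n≤1+n _)) (+-monoʳ-≤ℕ i D≤m)) (Q-outside-P-chord j)
    ; nc-ab-da = separated-chord (Q j) (P i) (PP (i<i+suc i d))
        (Q-outside-P-chord j) (P-outside-below i ℤₚ.≤-refl (+-monoʳ-≤ℕ i d+1≤m))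
    ; nc-bc-cd = separated-adjacent (P i₂) (Q j) bc-adj
    ; nc-bc-da = separated-adjacent (Q j) (P i) bc-adj
    ; nc-cd-da = separated-bridging i j (ℤₚ.i≤i+j i _) (+-monoʳ-≤ℕ i D≤m) ℤₚ.≤-refl (ℤₚ.i≤i+j j (+ n))
    }
    where
    i₁ i₂ : ℤ
    i₁ = i + + suc d
    i₂ = i + + suc (suc d)
    d+1≤m : suc d ≤ m
    d+1≤m = ℕₚ.≤-trans (ℕₚ.n≤1+n _) D≤m
    bc-adj : Adjacent (P i₁) (P i₂)
    bc-adj = P-step (i+[1+j]≡[i+j]+1 i (+ suc d))

  peripheral-Q : ∀ i l d → suc (suc d) ≤ n → Quad m n (Q (l + + suc (suc d))) (Q (l + + suc d)) (Q l) (P i)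
  peripheral-Q i l d D≤n = record
    { cyc = in₄ (PQ , Adjacent⇒<ₚ ab-adj , QQ (i<i+suc l d))
    ; ab = Adjacent⇒IsArc 1≤m 1≤n ab-adj ; bc = arc-Q l d d+1≤n ; cd = bQP ; da = bPQ
    ; ac = arc-Q l (suc d) D≤n ; bd = bQP
    ; nc-ab-bc = separated-adjacent (Q l₁) (Q l) ab-adj
    ; nc-ab-cd = separated-adjacent (Q l) (P i) ab-adj
    ; nc-ab-da = separated-adjacent (P i) (Q l₂) ab-adj
    ; nc-bc-cd = separated-chord (Q l) (P i) (QQ (i<i+suc l d))
        (Q-outside-below l ℤₚ.≤-refl (+-monoʳ-≤ℕ l d+1≤n)) (P-outside-Q-chord i)
    ; nc-bc-da = separated-chord (P i) (Q l₂) (QQ (i<i+suc l d))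
        (P-outside-Q-chord i) (Q-outside-above l₂ (+-monoʳ-≤ℕ l (ℕₚ.n≤1+n _)) (+-monoʳ-≤ℕ l D≤n))
    ; nc-cd-da = separated-sym (separated-bridging i l ℤₚ.≤-refl (ℤₚ.i≤i+j i (+ m)) (ℤₚ.i≤i+j l _) (+-monoʳ-≤ℕ l D≤n))
    }
    where
    l₁ l₂ : ℤ
    l₁ = l + + suc d
    l₂ = l + + suc (suc d)
    d+1≤n : suc d ≤ n
    d+1≤n = ℕₚ.≤-trans (ℕₚ.n≤1+n _) D≤n
    ab-adj : Adjacent (Q l₂) (Q l₁)
    ab-adj = Q-step (i+[1+j]≡[i+j]+1 l (+ suc d))

-- SL₂-tilings and Plücker functions

IsSL2Tiling : (ℤ → ℤ → ℤ) → Set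
IsSL2Tiling U = ∀ i j → U i j * U (i + 1ℤ) (j + 1ℤ) + 1ℤ ≡ U i (j + 1ℤ) * U (i + 1ℤ) j

module _ {a b c d a′ b′ c′ d′ : ℤ} (unimodular : a * d + 1ℤ ≡ b * c) (unimodular′ : a′ * d′ + 1ℤ ≡ b′ * c′) where

  private
    +1-injective : ∀ {x y} → x + 1ℤ ≡ y + 1ℤ → x ≡ y
    +1-injective {x} {y} eq = trans (sym ([x+1]-1≡x x)) (trans (cong (_- 1ℤ) eq) ([x+1]-1≡x y))
      where [x+1]-1≡x : ∀ x → (x + 1ℤ) - 1ℤ ≡ x
            [x+1]-1≡x = solve-∀

    cancel : ∀ {k x y} → 0ℤ ℤ.< k → k * x ≡ k * y → x ≡ y
    cancel {k} {x} {y} 0<k = ℤₚ.*-cancelˡ-≡ k x y ⦃ ℤ.>-nonZero 0<k ⦄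

  block-d : a ≡ a′ → b ≡ b′ → c ≡ c′ → 0ℤ ℤ.< a′ → d ≡ d′
  block-d refl refl refl 0<a = cancel 0<a (+1-injective (trans unimodular (sym unimodular′)))

  block-a : b ≡ b′ → c ≡ c′ → d ≡ d′ → 0ℤ ℤ.< d′ → a ≡ a′
  block-a refl refl refl 0<d =
    cancel 0<d (+1-injective (trans (cong (_+ 1ℤ) (ℤₚ.*-comm d a))
               (trans unimodular (trans (sym unimodular′) (cong (_+ 1ℤ) (ℤₚ.*-comm a′ d))))))

  block-b : a ≡ a′ → c ≡ c′ → d ≡ d′ → 0ℤ ℤ.< c′ → b ≡ b′
  block-b refl refl refl 0<c =
    cancel 0<c (trans (ℤₚ.*-comm c b) (trans (sym unimodular) (trans unimodular′ (ℤₚ.*-comm b′ c))))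

  block-c : a ≡ a′ → b ≡ b′ → d ≡ d′ → 0ℤ ℤ.< b′ → c ≡ c′
  block-c refl refl refl 0<b = cancel 0<b (trans (sym unimodular) unimodular′)

-- Each 2×2 block of a tiling determines any of its entries from the other three, so agreement on
-- row 0 and column 0 spreads to the whole plane, one row at a time.
tiling-unique : ∀ {V U} → IsSL2Tiling V → IsSL2Tiling U → (∀ i j → 0ℤ ℤ.< U i j) →
                (∀ j → V 0ℤ j ≡ U 0ℤ j) → (∀ i → V i 0ℤ ≡ U i 0ℤ) → ∀ i j → V i j ≡ U i j
tiling-unique {V} {U} V-tiling U-tiling U-pos row₀ col₀ =
  ℤ-induction (λ i → ∀ j → V i j ≡ U i j) row₀ next-row previous-row
  where
  next-row : ∀ i → (∀ j → V i j ≡ U i j) → ∀ j → V (i + 1ℤ) j ≡ U (i + 1ℤ) j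
  next-row i row = ℤ-induction (λ j → V (i + 1ℤ) j ≡ U (i + 1ℤ) j) (col₀ (i + 1ℤ))
    (λ j sw → block-d (V-tiling i j) (U-tiling i j) (row j) (row (j + 1ℤ)) sw (U-pos i j))
    (λ j se → block-c (V-tiling i j) (U-tiling i j) (row j) (row (j + 1ℤ)) se (U-pos i (j + 1ℤ)))

  previous-row : ∀ i → (∀ j → V (i + 1ℤ) j ≡ U (i + 1ℤ) j) → ∀ j → V i j ≡ U i j
  previous-row i row = ℤ-induction (λ j → V i j ≡ U i j) (col₀ i)
    (λ j nw → block-b (V-tiling i j) (U-tiling i j) nw (row j) (row (j + 1ℤ)) (U-pos (i + 1ℤ) j))
    (λ j ne → block-a (V-tiling i j) (U-tiling i j) ne (row j) (row (j + 1ℤ)) (U-pos (i + 1ℤ) (j + 1ℤ)))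

record IsPlückerFunction (G : Pt → Pt → ℤ) : Set where
  field
    antisym  : ∀ x y → G y x ≡ - G x y
    plücker  : ∀ w x y z → G w y * G x z ≡ G w x * G y z + G w z * G x y
    adjacent : ∀ {x y} → Adjacent x y → G x y ≡ 1ℤ

module PlückerFunction {G : Pt → Pt → ℤ} (isPlücker : IsPlückerFunction G) where
  open IsPlückerFunction isPlücker

  bridging-tiling : IsSL2Tiling (λ i j → G (P i) (Q j))
  bridging-tiling i j = begin
    G (P i) (Q j) * G (P (i + 1ℤ)) (Q (j + 1ℤ)) + 1ℤ
      ≡⟨ ℤₚ.+-comm (G (P i) (Q j) * G (P (i + 1ℤ)) (Q (j + 1ℤ))) 1ℤ ⟩
    1ℤ + G (P i) (Q j) * G (P (i + 1ℤ)) (Q (j + 1ℤ))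
      ≡⟨ cong₂ (λ x y → x * y + G (P i) (Q j) * G (P (i + 1ℤ)) (Q (j + 1ℤ)))
               (sym (adjacent (P-step refl))) (sym (adjacent (Q-step refl))) ⟩
    G (P i) (P (i + 1ℤ)) * G (Q (j + 1ℤ)) (Q j) + G (P i) (Q j) * G (P (i + 1ℤ)) (Q (j + 1ℤ))
      ≡⟨ sym (plücker (P i) (P (i + 1ℤ)) (Q (j + 1ℤ)) (Q j)) ⟩
    G (P i) (Q (j + 1ℤ)) * G (P (i + 1ℤ)) (Q j) ∎
    where open ≡-Reasoning

  PP-via-bridging : ∀ i l → G (P i) (P l) ≡ G (P i) (Q 1ℤ) * G (P l) (Q 0ℤ) - G (P i) (Q 0ℤ) * G (P l) (Q 1ℤ)
  PP-via-bridging i l = solve-for-g (G (P i) (Q 0ℤ) * G (P l) (Q 1ℤ)) (begin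
    G (P i) (Q 1ℤ) * G (P l) (Q 0ℤ)                                       ≡⟨ plücker (P i) (P l) (Q 1ℤ) (Q 0ℤ) ⟩
    G (P i) (P l) * G (Q 1ℤ) (Q 0ℤ) + G (P i) (Q 0ℤ) * G (P l) (Q 1ℤ)   ≡⟨ cong (λ x → G (P i) (P l) * x + G (P i) (Q 0ℤ) * G (P l) (Q 1ℤ)) (adjacent (Q-step refl)) ⟩
    G (P i) (P l) * 1ℤ + G (P i) (Q 0ℤ) * G (P l) (Q 1ℤ)                 ∎)
    where
    open ≡-Reasoning
    solve-for-g : ∀ {g x} y → x ≡ g * 1ℤ + y → g ≡ x - y
    solve-for-g {g} y refl = [g*1+y]-y g y
      where [g*1+y]-y : ∀ g y → g ≡ (g * 1ℤ + y) - y
            [g*1+y]-y = solve-∀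

  QQ-via-bridging : ∀ j l → G (Q j) (Q l) ≡ G (P 0ℤ) (Q j) * G (P 1ℤ) (Q l) - G (P 0ℤ) (Q l) * G (P 1ℤ) (Q j)
  QQ-via-bridging j l = solve-for-g (G (P 0ℤ) (Q j) * G (P 1ℤ) (Q l)) (G (P 0ℤ) (Q l)) (G (P 1ℤ) (Q j)) (begin
    1ℤ * G (Q j) (Q l)                                                     ≡⟨ cong (_* G (Q j) (Q l)) (sym (adjacent (P-step refl))) ⟩
    G (P 0ℤ) (P 1ℤ) * G (Q j) (Q l)                                       ≡⟨ plücker (P 0ℤ) (Q j) (P 1ℤ) (Q l) ⟩
    G (P 0ℤ) (Q j) * G (P 1ℤ) (Q l) + G (P 0ℤ) (Q l) * G (Q j) (P 1ℤ)   ≡⟨ cong (λ x → G (P 0ℤ) (Q j) * G (P 1ℤ) (Q l) + G (P 0ℤ) (Q l) * x) (antisym (P 1ℤ) (Q j)) ⟩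
    G (P 0ℤ) (Q j) * G (P 1ℤ) (Q l) + G (P 0ℤ) (Q l) * - G (P 1ℤ) (Q j) ∎)
    where
    open ≡-Reasoning
    solve-for-g : ∀ {g} x y z → 1ℤ * g ≡ x + y * - z → g ≡ x - y * z
    solve-for-g {g} x y z eq = trans (sym (ℤₚ.*-identityˡ g)) (trans eq ([x+y*-z]≡x-y*z x y z))
      where [x+y*-z]≡x-y*z : ∀ x y z → x + y * - z ≡ x - y * z
            [x+y*-z]≡x-y*z = solve-∀

  ∣G∣-sym : ∀ x y → ∣ G x y ∣ ≡ ∣ G y x ∣
  ∣G∣-sym x y = sym (trans (cong ∣_∣ (antisym x y)) (ℤₚ.∣-i∣≡∣i∣ (G x y)))

  module _ (bridging-pos : ∀ i j → 0ℤ ℤ.< G (P i) (Q j)) where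

    private
      positive-PP : ∀ d i → 0ℤ ℤ.< G (P i) (P (i + + suc d))
      positive-PP zero    i = subst (0ℤ ℤ.<_) (sym (adjacent (P-step refl))) (+<+ (s≤s z≤n))
      positive-PP (suc d) i = pos-*-cancelʳ (bridging-pos i₁ 0ℤ)
        (subst (0ℤ ℤ.<_) (sym (plücker (P i) (P i₁) (P i₂) (Q 0ℤ)))
               (ℤₚ.+-mono-< (*-pos (positive-PP d i) (bridging-pos i₂ 0ℤ)) (*-pos (bridging-pos i 0ℤ) step-pos)))
        where
        i₁ i₂ : ℤ
        i₁ = i + + suc d
        i₂ = i + + suc (suc d)
        step-pos : 0ℤ ℤ.< G (P i₁) (P i₂)
        step-pos = subst (0ℤ ℤ.<_) (sym (adjacent (P-step (i+[1+j]≡[i+j]+1 i (+ suc d))))) (+<+ (s≤s z≤n))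

      positive-QQ : ∀ d l → 0ℤ ℤ.< G (Q (l + + suc d)) (Q l)
      positive-QQ zero    l = subst (0ℤ ℤ.<_) (sym (adjacent (Q-step refl))) (+<+ (s≤s z≤n))
      positive-QQ (suc d) l = pos-*-cancelˡ (bridging-pos 0ℤ l₁)
        (subst (0ℤ ℤ.<_) (sym (plücker (P 0ℤ) (Q l₂) (Q l₁) (Q l)))
               (ℤₚ.+-mono-< (*-pos (bridging-pos 0ℤ l₂) (positive-QQ d l)) (*-pos (bridging-pos 0ℤ l) step-pos)))
        where
        l₁ l₂ : ℤ
        l₁ = l + + suc d
        l₂ = l + + suc (suc d)
        step-pos : 0ℤ ℤ.< G (Q l₂) (Q l₁)
        step-pos = subst (0ℤ ℤ.<_) (sym (adjacent (Q-step (i+[1+j]≡[i+j]+1 l (+ suc d))))) (+<+ (s≤s z≤n))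

    positive : ∀ {x y} → x <ₚ y → 0ℤ ℤ.< G x y
    positive (PP i<k) with <⇒≡+suc i<k
    ... | d , refl = positive-PP d _
    positive PQ = bridging-pos _ _
    positive (QQ l<j) with <⇒≡+suc l<j
    ... | d , refl = positive-QQ d _

    PtolemyAt : Pt → Pt → Pt → Pt → Set
    PtolemyAt A B C D =
      ∣ G A C ∣ ℕ.* ∣ G B D ∣ ≡ ∣ G A B ∣ ℕ.* ∣ G C D ∣ ℕ.+ ∣ G B C ∣ ℕ.* ∣ G D A ∣

    private
      ptolemy-increasing : ∀ {A B C D} → Inc4 A B C D → PtolemyAt A B C D
      ptolemy-increasing {A} {B} {C} {D} (a<b , b<c , c<d) = begin
        ∣ G A C ∣ ℕ.* ∣ G B D ∣                           ≡⟨ abs-ptolemy (positive a<c) (positive b<d) (positive a<b)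
                                                              (positive c<d) (positive a<d) (positive b<c) (plücker A B C D) ⟩
        ∣ G A B ∣ ℕ.* ∣ G C D ∣ ℕ.+ ∣ G A D ∣ ℕ.* ∣ G B C ∣ ≡⟨ cong (∣ G A B ∣ ℕ.* ∣ G C D ∣ ℕ.+_)
                                                              (trans (ℕₚ.*-comm ∣ G A D ∣ ∣ G B C ∣) (cong (∣ G B C ∣ ℕ.*_) (∣G∣-sym A D))) ⟩
        ∣ G A B ∣ ℕ.* ∣ G C D ∣ ℕ.+ ∣ G B C ∣ ℕ.* ∣ G D A ∣ ∎
        where
        open ≡-Reasoning
        a<c : A <ₚ C
        a<c = <ₚ-trans a<b b<c
        b<d : B <ₚ D
        b<d = <ₚ-trans b<c c<d
        a<d : A <ₚ D
        a<d = <ₚ-trans a<b b<d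

      ptolemy-rotate : ∀ {A B C D} → PtolemyAt B C D A → PtolemyAt A B C D
      ptolemy-rotate {A} {B} {C} {D} ptolemy = begin
        ∣ G A C ∣ ℕ.* ∣ G B D ∣                           ≡⟨ trans (cong (ℕ._* ∣ G B D ∣) (∣G∣-sym A C)) (ℕₚ.*-comm ∣ G C A ∣ ∣ G B D ∣) ⟩
        ∣ G B D ∣ ℕ.* ∣ G C A ∣                           ≡⟨ ptolemy ⟩
        ∣ G B C ∣ ℕ.* ∣ G D A ∣ ℕ.+ ∣ G C D ∣ ℕ.* ∣ G A B ∣ ≡⟨ ℕₚ.+-comm (∣ G B C ∣ ℕ.* ∣ G D A ∣) _ ⟩
        ∣ G C D ∣ ℕ.* ∣ G A B ∣ ℕ.+ ∣ G B C ∣ ℕ.* ∣ G D A ∣ ≡⟨ cong (ℕ._+ ∣ G B C ∣ ℕ.* ∣ G D A ∣) (ℕₚ.*-comm ∣ G C D ∣ ∣ G A B ∣) ⟩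
        ∣ G A B ∣ ℕ.* ∣ G C D ∣ ℕ.+ ∣ G B C ∣ ℕ.* ∣ G D A ∣ ∎
        where open ≡-Reasoning

      ptolemy-reflect : ∀ {A B C D} → PtolemyAt D C B A → PtolemyAt A B C D
      ptolemy-reflect {A} {B} {C} {D} ptolemy = begin
        ∣ G A C ∣ ℕ.* ∣ G B D ∣                           ≡⟨ trans (cong₂ ℕ._*_ (∣G∣-sym A C) (∣G∣-sym B D)) (ℕₚ.*-comm ∣ G C A ∣ ∣ G D B ∣) ⟩
        ∣ G D B ∣ ℕ.* ∣ G C A ∣                           ≡⟨ ptolemy ⟩
        ∣ G D C ∣ ℕ.* ∣ G B A ∣ ℕ.+ ∣ G C B ∣ ℕ.* ∣ G A D ∣ ≡⟨ cong₂ ℕ._+_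
                                                              (trans (cong₂ ℕ._*_ (∣G∣-sym D C) (∣G∣-sym B A)) (ℕₚ.*-comm ∣ G C D ∣ ∣ G A B ∣))
                                                              (cong₂ ℕ._*_ (∣G∣-sym C B) (∣G∣-sym A D)) ⟩
        ∣ G A B ∣ ℕ.* ∣ G C D ∣ ℕ.+ ∣ G B C ∣ ℕ.* ∣ G D A ∣ ∎
        where open ≡-Reasoning

    ptolemy-cyclic : ∀ {A B C D} → Cyclic A B C D → PtolemyAt A B C D
    ptolemy-cyclic (in₁ inc) = ptolemy-increasing inc
    ptolemy-cyclic (in₂ inc) = ptolemy-rotate (ptolemy-increasing inc)
    ptolemy-cyclic (in₃ inc) = ptolemy-rotate (ptolemy-rotate (ptolemy-increasing inc))
    ptolemy-cyclic (in₄ inc) = ptolemy-rotate (ptolemy-rotate (ptolemy-rotate (ptolemy-increasing inc)))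
    ptolemy-cyclic (in₅ inc) = ptolemy-reflect (ptolemy-increasing inc)
    ptolemy-cyclic (in₆ inc) = ptolemy-reflect (ptolemy-rotate (ptolemy-increasing inc))
    ptolemy-cyclic (in₇ inc) = ptolemy-reflect (ptolemy-rotate (ptolemy-rotate (ptolemy-increasing inc)))
    ptolemy-cyclic (in₈ inc) = ptolemy-reflect (ptolemy-rotate (ptolemy-rotate (ptolemy-rotate (ptolemy-increasing inc))))

determined-by-bridging : ∀ {G G′} → IsPlückerFunction G → IsPlückerFunction G′ →
                         (∀ i j → G (P i) (Q j) ≡ G′ (P i) (Q j)) → ∀ x y → G x y ≡ G′ x y
determined-by-bridging {G} {G′} isPl isPl′ same = same-everywhere
  where
  open PlückerFunction
  open IsPlückerFunction
  same-everywhere : ∀ x y → G x y ≡ G′ x y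
  same-everywhere (P i) (Q j) = same i j
  same-everywhere (Q j) (P i) =
    trans (antisym isPl (P i) (Q j)) (trans (cong -_ (same i j)) (sym (antisym isPl′ (P i) (Q j))))
  same-everywhere (P i) (P l) = begin
    G (P i) (P l)                                                          ≡⟨ PP-via-bridging isPl i l ⟩
    G (P i) (Q 1ℤ) * G (P l) (Q 0ℤ) - G (P i) (Q 0ℤ) * G (P l) (Q 1ℤ)     ≡⟨ cong₂ _-_ (cong₂ _*_ (same i 1ℤ) (same l 0ℤ))
                                                                                           (cong₂ _*_ (same i 0ℤ) (same l 1ℤ)) ⟩
    G′ (P i) (Q 1ℤ) * G′ (P l) (Q 0ℤ) - G′ (P i) (Q 0ℤ) * G′ (P l) (Q 1ℤ) ≡⟨ sym (PP-via-bridging isPl′ i l) ⟩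
    G′ (P i) (P l)                                                         ∎
    where open ≡-Reasoning
  same-everywhere (Q j) (Q l) = begin
    G (Q j) (Q l)                                                          ≡⟨ QQ-via-bridging isPl j l ⟩
    G (P 0ℤ) (Q j) * G (P 1ℤ) (Q l) - G (P 0ℤ) (Q l) * G (P 1ℤ) (Q j)     ≡⟨ cong₂ _-_ (cong₂ _*_ (same 0ℤ j) (same 1ℤ l))
                                                                                           (cong₂ _*_ (same 0ℤ l) (same 1ℤ j)) ⟩
    G′ (P 0ℤ) (Q j) * G′ (P 1ℤ) (Q l) - G′ (P 0ℤ) (Q l) * G′ (P 1ℤ) (Q j) ≡⟨ sym (QQ-via-bridging isPl′ j l) ⟩
    G′ (Q j) (Q l)                                                         ∎
    where open ≡-Reasoning

-- From quasi-friezes to friezes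

ℤ² : Set
ℤ² = ℤ × ℤ

det : ℤ² → ℤ² → ℤ
det (a , b) (c , d) = a * d - b * c

det-antisym : ∀ x y → det y x ≡ - det x y
det-antisym (a , b) (c , d) = antisym a b c d
  where antisym : ∀ a b c d → c * b - d * a ≡ - (a * d - b * c)
        antisym = solve-∀

det-plücker : ∀ x y z w → det x z * det y w ≡ det x y * det z w + det x w * det y z
det-plücker (a , b) (c , d) (e , f) (g , h) = plücker a b c d e f g h
  where plücker : ∀ a b c d e f g h → (a * f - b * e) * (c * h - d * g) ≡
                                       (a * d - b * c) * (e * h - f * g) + (a * h - b * g) * (c * f - d * e)
        plücker = solve-∀

module Realisation (U : ℤ → ℤ → ℤ) (U-tiling : IsSL2Tiling U) (U-pos : ∀ i j → 0ℤ ℤ.< U i j) where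

  private
    minor : ℤ → ℤ → ℤ
    minor i j = U i (j + 1ℤ) * U (i + 1ℤ) j - U i j * U (i + 1ℤ) (j + 1ℤ)

    minor≡1 : ∀ i j → minor i j ≡ 1ℤ
    minor≡1 i j = trans (cong (_- U i j * U (i + 1ℤ) (j + 1ℤ)) (sym (U-tiling i j)))
                        ([x+1]-x≡1 (U i j * U (i + 1ℤ) (j + 1ℤ)))
      where [x+1]-x≡1 : ∀ x → (x + 1ℤ) - x ≡ 1ℤ
            [x+1]-x≡1 = solve-∀

  a : ℤ → ℤ²
  a i = U i 0ℤ , - U i 1ℤ

  -- Cramer's rule for det (a 0) (b j) = U 0 j and det (a 1) (b j) = U 1 j, as det (a 0) (a 1) = 1.
  b : ℤ → ℤ²
  b j = U 1ℤ 0ℤ * U 0ℤ j - U 0ℤ 0ℤ * U 1ℤ j , U 0ℤ 1ℤ * U 1ℤ j - U 1ℤ 1ℤ * U 0ℤ j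

  vec : Pt → ℤ²
  vec (P i) = a i
  vec (Q j) = b j

  G : Pt → Pt → ℤ
  G x y = det (vec x) (vec y)

  private
    det-a-a : ∀ i → det (a i) (a (i + 1ℤ)) ≡ 1ℤ
    det-a-a i = trans (expand (U i 0ℤ) (U i 1ℤ) (U (i + 1ℤ) 0ℤ) (U (i + 1ℤ) 1ℤ)) (minor≡1 i 0ℤ)
      where expand : ∀ w x y z → w * - z - - x * y ≡ x * y - w * z
            expand = solve-∀

    det-b-b : ∀ j → det (b (j + 1ℤ)) (b j) ≡ 1ℤ
    det-b-b j = begin
      det (b (j + 1ℤ)) (b j)
        ≡⟨ expand (U 0ℤ 0ℤ) (U 0ℤ 1ℤ) (U 1ℤ 0ℤ) (U 1ℤ 1ℤ) (U 0ℤ j) (U 1ℤ j) (U 0ℤ (j + 1ℤ)) (U 1ℤ (j + 1ℤ)) ⟩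
      minor 0ℤ 0ℤ * minor 0ℤ j
        ≡⟨ cong₂ _*_ (minor≡1 0ℤ 0ℤ) (minor≡1 0ℤ j) ⟩
      1ℤ
        ∎
      where
      open ≡-Reasoning
      expand : ∀ A B C D x y x′ y′ → (C * x′ - A * y′) * (B * y - D * x) - (B * y′ - D * x′) * (C * x - A * y)
                                     ≡ (B * C - A * D) * (x′ * y - x * y′)
      expand = solve-∀

    det-a₀-b : ∀ j → det (a 0ℤ) (b j) ≡ U 0ℤ j
    det-a₀-b j = trans (expand (U 0ℤ 0ℤ) (U 0ℤ 1ℤ) (U 1ℤ 0ℤ) (U 1ℤ 1ℤ) (U 0ℤ j) (U 1ℤ j))
                       (trans (cong (U 0ℤ j *_) (minor≡1 0ℤ 0ℤ)) (ℤₚ.*-identityʳ (U 0ℤ j)))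
      where expand : ∀ A B C D x y → A * (B * y - D * x) - - B * (C * x - A * y) ≡ x * (B * C - A * D)
            expand = solve-∀

    det-a-b₀ : ∀ i → det (a i) (b 0ℤ) ≡ U i 0ℤ
    det-a-b₀ i = trans (expand (U 0ℤ 0ℤ) (U 0ℤ 1ℤ) (U 1ℤ 0ℤ) (U 1ℤ 1ℤ) (U i 0ℤ) (U i 1ℤ))
                       (trans (cong (U i 0ℤ *_) (minor≡1 0ℤ 0ℤ)) (ℤₚ.*-identityʳ (U i 0ℤ)))
      where expand : ∀ A B C D x y → x * (B * C - D * A) - - y * (C * A - A * C) ≡ x * (B * C - A * D)
            expand = solve-∀

  G-isPlücker : IsPlückerFunction G
  G-isPlücker = record
    { antisym  = λ x y → det-antisym (vec x) (vec y)
    ; plücker  = λ w x y z → det-plücker (vec w) (vec x) (vec y) (vec z)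
    ; adjacent = λ { (P-step refl) → det-a-a _ ; (Q-step refl) → det-b-b _ }
    }

  G-bridging : ∀ i j → G (P i) (Q j) ≡ U i j
  G-bridging = tiling-unique (PlückerFunction.bridging-tiling G-isPlücker) U-tiling U-pos det-a₀-b det-a-b₀

module FriezeOf {m n : ℕ} (u : ℤ → ℤ → ℕ) (u-biqf : IsPosIntBiQF u) (u-periodic : Periodic m n u) where

  private
    U : ℤ → ℤ → ℤ
    U i j = + u i j

    U-tiling : IsSL2Tiling U
    U-tiling i j = begin
      U i j * U (i + 1ℤ) (j + 1ℤ) + 1ℤ         ≡⟨ cong (_+ 1ℤ) (sym (ℤₚ.pos-* (u i j) (u (i + 1ℤ) (j + 1ℤ)))) ⟩
      + (u i j ℕ.* u (i + 1ℤ) (j + 1ℤ)) + 1ℤ   ≡⟨ sym (ℤₚ.pos-+ (u i j ℕ.* u (i + 1ℤ) (j + 1ℤ)) 1) ⟩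
      + (u i j ℕ.* u (i + 1ℤ) (j + 1ℤ) ℕ.+ 1) ≡⟨ cong +_ (proj₂ u-biqf i j) ⟩
      + (u i (j + 1ℤ) ℕ.* u (i + 1ℤ) j)       ≡⟨ ℤₚ.pos-* (u i (j + 1ℤ)) (u (i + 1ℤ) j) ⟩
      U i (j + 1ℤ) * U (i + 1ℤ) j              ∎
      where open ≡-Reasoning

    U-pos : ∀ i j → 0ℤ ℤ.< U i j
    U-pos i j = +<+ (proj₁ u-biqf i j)

  open Realisation U U-tiling U-pos
  open PlückerFunction G-isPlücker
  open IsPlückerFunction G-isPlücker

  private
    G-bridging-pos : ∀ i j → 0ℤ ℤ.< G (P i) (Q j)
    G-bridging-pos i j = subst (0ℤ ℤ.<_) (sym (G-bridging i j)) (U-pos i j)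

    periodic-multiple : ∀ k i j → u (i + k * + m) (j + k * + n) ≡ u i j
    periodic-multiple = ℤ-induction (λ k → ∀ i j → u (i + k * + m) (j + k * + n) ≡ u i j)
      (λ i j → cong₂ u (ℤₚ.+-identityʳ i) (ℤₚ.+-identityʳ j))
      (λ k periodic i j → trans (cong₂ u (sym (step i k (+ m))) (sym (step j k (+ n))))
                                (trans (u-periodic (i + k * + m) (j + k * + n)) (periodic i j)))
      (λ k periodic i j → trans (sym (u-periodic (i + k * + m) (j + k * + n)))
                                (trans (cong₂ u (step i k (+ m)) (step j k (+ n))) (periodic i j)))
      where step : ∀ i k s → (i + k * s) + s ≡ i + (k + 1ℤ) * s
            step = solve-∀

    G-shift : ∀ k x y → G (shift m n k x) (shift m n k y) ≡ G x y
    G-shift k = determined-by-bridging shifted G-isPlücker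
      (λ i j → trans (G-bridging _ _) (trans (cong +_ (periodic-multiple k i j)) (sym (G-bridging i j))))
      where
      shifted : IsPlückerFunction (λ x y → G (shift m n k x) (shift m n k y))
      shifted = record
        { antisym  = λ x y → antisym (shift m n k x) (shift m n k y)
        ; plücker  = λ w x y z → plücker (shift m n k w) (shift m n k x) (shift m n k y) (shift m n k z)
        ; adjacent = λ adj → adjacent (Adjacent-shift k adj)
        }

  friezeOf : Frieze m n
  friezeOf = record
    { F       = λ α → ∣ G (src α) (tgt α) ∣
    ; F-resp  = shift-invariant
    ; F-pos   = λ α → positive-on-arcs (valid α)
    ; F-bdry  = λ α → one-on-boundary
    ; ptolemy = λ A B C D q → ptolemy-cyclic G-bridging-pos (Quad.cyc q)
    }
    where
    shift-invariant : ∀ α β → α ≈A β → ∣ G (src α) (tgt α) ∣ ≡ ∣ G (src β) (tgt β) ∣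
    shift-invariant (arc s t _) (arc _ _ _) (k , inj₁ (refl , refl)) = cong ∣_∣ (sym (G-shift k s t))
    shift-invariant (arc s t _) (arc _ _ _) (k , inj₂ (refl , refl)) = trans (∣G∣-sym s t) (cong ∣_∣ (sym (G-shift k t s)))

    positive-on-arcs : ∀ {x y} → IsArc m n x y → 0 ℕ.< ∣ G x y ∣
    positive-on-arcs {x} {y} xy with IsArc⇒<ₚ⊎>ₚ xy
    ... | inj₁ x<y = 0<⇒0<∣∣ (positive G-bridging-pos x<y)
    ... | inj₂ y<x = subst (0 ℕ.<_) (∣G∣-sym y x) (0<⇒0<∣∣ (positive G-bridging-pos y<x))

    one-on-boundary : ∀ {x y} → IsBdrySeg x y → ∣ G x y ∣ ≡ 1
    one-on-boundary {x} {y} bdry with IsBdrySeg⇒Adjacent bdry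
    ... | inj₁ adj = cong ∣_∣ (adjacent adj)
    ... | inj₂ adj = trans (∣G∣-sym x y) (cong ∣_∣ (adjacent adj))

  toBiQF-friezeOf : ∀ i j → toBiQF friezeOf i j ≡ u i j
  toBiQF-friezeOf i j = cong ∣_∣ (G-bridging i j)

-- From friezes to quasi-friezes

module _ {m n : ℕ} (H : Frieze m n) where

  shift-zero : ∀ x → shift m n 0ℤ x ≡ x
  shift-zero (P i) = cong P (ℤₚ.+-identityʳ i)
  shift-zero (Q j) = cong Q (ℤₚ.+-identityʳ j)

  F-irrelevant : ∀ {s t} (p p′ : IsArc m n s t) → F H (arc s t p) ≡ F H (arc s t p′)
  F-irrelevant {s} {t} p p′ = F-resp H (arc s t p) (arc s t p′) (0ℤ , inj₁ (sym (shift-zero s) , sym (shift-zero t)))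

  F-reverse : ∀ {s t} (p : IsArc m n s t) (p′ : IsArc m n t s) → F H (arc s t p) ≡ F H (arc t s p′)
  F-reverse {s} {t} p p′ = F-resp H (arc s t p) (arc t s p′) (0ℤ , inj₂ (sym (shift-zero t) , sym (shift-zero s)))

  F-adjacent : ∀ {s t} (p : IsArc m n s t) → Adjacent s t → F H (arc s t p) ≡ 1
  F-adjacent p adj = F-bdry H (arc _ _ p) (Adjacent⇒IsBdrySeg adj)

  toBiQF-periodic : Periodic m n (toBiQF H)
  toBiQF-periodic i j =
    sym (F-resp H (γ i j) (γ (i + + m) (j + + n)) (1ℤ , inj₁ (cong P (shift-by-one i m) , cong Q (shift-by-one j n))))
    where shift-by-one : ∀ i s → i + + s ≡ i + 1ℤ * + s
          shift-by-one i s = cong (_+_ i) (sym (ℤₚ.*-identityˡ (+ s)))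

  toBiQF-isPosIntBiQF : 1 ≤ m → 1 ≤ n → IsPosIntBiQF (toBiQF H)
  toBiQF-isPosIntBiQF 1≤m 1≤n = (λ i j → F-pos H (γ i j)) , unimodular
    where
    open Quadrilaterals 1≤m 1≤n
    unimodular : ∀ i j → toBiQF H i j ℕ.* toBiQF H (i + 1ℤ) (j + 1ℤ) ℕ.+ 1 ≡ toBiQF H i (j + 1ℤ) ℕ.* toBiQF H (i + 1ℤ) j
    unimodular i j = begin
      toBiQF H i j ℕ.* toBiQF H (i + 1ℤ) (j + 1ℤ) ℕ.+ 1
        ≡⟨ ℕₚ.+-comm (toBiQF H i j ℕ.* toBiQF H (i + 1ℤ) (j + 1ℤ)) 1 ⟩
      1 ℕ.+ toBiQF H i j ℕ.* toBiQF H (i + 1ℤ) (j + 1ℤ)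
        ≡⟨ cong₂ ℕ._+_ (sym (cong₂ ℕ._*_ (F-adjacent ab (P-step refl)) (F-adjacent cd (Q-step refl))))
                       (trans (ℕₚ.*-comm (toBiQF H i j) _) (cong (toBiQF H (i + 1ℤ) (j + 1ℤ) ℕ.*_) (F-reverse bPQ da))) ⟩
      F H (arc _ _ ab) ℕ.* F H (arc _ _ cd) ℕ.+ toBiQF H (i + 1ℤ) (j + 1ℤ) ℕ.* F H (arc _ _ da)
        ≡⟨ sym (ptolemy H _ _ _ _ (square i j)) ⟩
      toBiQF H i (j + 1ℤ) ℕ.* toBiQF H (i + 1ℤ) j
        ∎
      where
      open ≡-Reasoning
      open Quad (square i j)

module Uniqueness {m n : ℕ} (1≤m : 1 ≤ m) (1≤n : 1 ≤ n) (H K : Frieze m n)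
                  (same-γ : ∀ i j → toBiQF H i j ≡ toBiQF K i j) where

  open Quadrilaterals 1≤m 1≤n

  Agree : Pt → Pt → Set
  Agree s t = ∀ p → F H (arc s t p) ≡ F K (arc s t p)

  private
    agree-from : ∀ {s t} (p : IsArc m n s t) → F H (arc s t p) ≡ F K (arc s t p) → Agree s t
    agree-from p agree p′ = trans (F-irrelevant H p′ p) (trans agree (F-irrelevant K p p′))

    agree-reverse : ∀ {s t} → Agree s t → Agree t s
    agree-reverse agree p =
      trans (F-reverse H p (IsArc-sym p)) (trans (agree (IsArc-sym p)) (sym (F-reverse K p (IsArc-sym p))))

    agree-PQ : ∀ {i j} → Agree (P i) (Q j)
    agree-PQ {i} {j} bPQ = same-γ i j

    agree-QP : ∀ {i j} → Agree (Q j) (P i)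
    agree-QP = agree-reverse agree-PQ

    agree-adjacent : ∀ {s t} → Adjacent s t → Agree s t
    agree-adjacent adj p = trans (F-adjacent H p adj) (sym (F-adjacent K p adj))

    agree-diagonal : ∀ {A B C D} → Quad m n A B C D →
                     Agree A B → Agree B C → Agree C D → Agree D A → Agree B D → Agree A C
    agree-diagonal {A} {B} {C} {D} q ab= bc= cd= da= bd= =
      agree-from ac (ℕₚ.*-cancelʳ-≡ _ _ _ ⦃ ℕ.>-nonZero (F-pos H (arc B D bd)) ⦄ (begin
      F H (arc A C ac) ℕ.* F H (arc B D bd)                              ≡⟨ ptolemy H A B C D q ⟩
      F H (arc A B ab) ℕ.* F H (arc C D cd) ℕ.+ F H (arc B C bc) ℕ.* F H (arc D A da)
        ≡⟨ cong₂ ℕ._+_ (cong₂ ℕ._*_ (ab= ab) (cd= cd)) (cong₂ ℕ._*_ (bc= bc) (da= da)) ⟩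
      F K (arc A B ab) ℕ.* F K (arc C D cd) ℕ.+ F K (arc B C bc) ℕ.* F K (arc D A da) ≡⟨ sym (ptolemy K A B C D q) ⟩
      F K (arc A C ac) ℕ.* F K (arc B D bd)                              ≡⟨ cong (F K (arc A C ac) ℕ.*_) (sym (bd= bd)) ⟩
      F K (arc A C ac) ℕ.* F H (arc B D bd)                              ∎))
      where
      open ≡-Reasoning
      open Quad q

    agree-P : ∀ d i → suc d ≤ m → Agree (P i) (P (i + + suc d))
    agree-P zero    i _   = agree-adjacent (P-step refl)
    agree-P (suc d) i D≤m = agree-diagonal (peripheral-P i 0ℤ d D≤m)
      (agree-P d i (ℕₚ.≤-trans (ℕₚ.n≤1+n _) D≤m)) (agree-adjacent (P-step (i+[1+j]≡[i+j]+1 i (+ suc d))))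
      agree-PQ agree-QP agree-PQ

    agree-Q : ∀ d l → suc d ≤ n → Agree (Q (l + + suc d)) (Q l)
    agree-Q zero    l _   = agree-adjacent (Q-step refl)
    agree-Q (suc d) l D≤n = agree-diagonal (peripheral-Q 0ℤ l d D≤n)
      (agree-adjacent (Q-step (i+[1+j]≡[i+j]+1 l (+ suc d)))) (agree-Q d l (ℕₚ.≤-trans (ℕₚ.n≤1+n _) D≤n))
      agree-QP agree-PQ agree-QP

  agree : ∀ {s t} → IsArc m n s t → Agree s t
  agree bPQ = agree-PQ
  agree bQP = agree-QP
  agree (pP {i} {k} 1≤ ≤m) with apart-by {i} {k} 1≤ ≤m
  ... | d , d+1≤m , inj₁ refl = agree-P d i d+1≤m
  ... | d , d+1≤m , inj₂ refl = agree-reverse (agree-P d k d+1≤m)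
  agree (pQ {j} {l} 1≤ ≤n) with apart-by {j} {l} 1≤ ≤n
  ... | d , d+1≤n , inj₁ refl = agree-reverse (agree-Q d j d+1≤n)
  ... | d , d+1≤n , inj₂ refl = agree-Q d l d+1≤n

  frieze-unique : ∀ α → F H α ≡ F K α
  frieze-unique (arc s t p) = agree p p

theorem4p2 : (m n : ℕ) → 1 ≤ m → 1 ≤ n →
    ((Fr : Frieze m n) → IsPosIntBiQF (toBiQF Fr) × Periodic m n (toBiQF Fr))
    × ((Fr Gr : Frieze m n) → (∀ i j → toBiQF Fr i j ≡ toBiQF Gr i j) →
        ∀ α → F Fr α ≡ F Gr α)
    × ((u : ℤ → ℤ → ℕ) → IsPosIntBiQF u → Periodic m n u →
        Σ (Frieze m n) (λ Fr → ∀ i j → toBiQF Fr i j ≡ u i j))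
theorem4p2 m n 1≤m 1≤n =
    (λ H → toBiQF-isPosIntBiQF H 1≤m 1≤n , toBiQF-periodic H)
  , (λ H K same-γ → Uniqueness.frieze-unique 1≤m 1≤n H K same-γ)
  , (λ u u-biqf u-periodic → FriezeOf.friezeOf u u-biqf u-periodic , FriezeOf.toBiQF-friezeOf u u-biqf u-periodic)
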